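{- Let $L$ be a discrete, semimodular join semilattice. Then the Chebyshev distance $d(x,y)=\max\bigl[h(x,x\vee y),\,h(y,x\vee y)\bigr]$ on $L$ is a metric, i.e. it satisfies $d(x,z)\leq d(x,y)+d(y,z)$ for all $x,y,z\in L$.
   Context: A poset is discrete if every maximal chain in every interval $[x,y]=\{w: x\leq w\leq y\}$ is finite. In a discrete poset, for comparable elements $x\leq y$, the height $h(x,y)=h(y,x)$ is the least cardinality of a maximal chain of $[x,y]$ minus $1$. A join semilattice $L$ is semimodular if for all distinct $x,y\in L$, whenever some element $z$ is covered by both $x$ and $y$, the join $x\vee y$ covers both $x$ and $y$. -}

module Defs where

open import Level using (Level; _⊔_)
open import Data.Nat as ℕ using (ℕ; suc)
open import Data.Product using (Σ; ∃; _×_; _,_)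
open import Data.Sum using (_⊎_)
open import Data.List using (List; length)
open import Data.List.Relation.Unary.All using (All)
open import Data.List.Relation.Unary.Any using (Any)
open import Data.List.Relation.Unary.AllPairs using (AllPairs)
open import Relation.Nullary using (¬_)
open import Relation.Unary using (Pred; _⊆_)
open import Relation.Binary.PropositionalEquality using (_≡_)
open import Relation.Binary.Lattice.Bundles using (JoinSemilattice)

module _ {c ℓ₁ ℓ₂ : Level} (L : JoinSemilattice c ℓ₁ ℓ₂) where
  open JoinSemilattice L

  -- subsets of L: predicates (at a level large enough for all subsets
  -- definable from the structure) that respect the setoid equality
  Subset : Set _
  Subset = Pred Carrier (c ⊔ ℓ₁ ⊔ ℓ₂)

  _<_ : Carrier → Carrier → Set (ℓ₁ ⊔ ℓ₂)
  a < b = a ≤ b × ¬ (a ≈ b)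

  _⋖_ : Carrier → Carrier → Set (c ⊔ ℓ₁ ⊔ ℓ₂)
  z ⋖ x = z < x × (∀ w → z < w → ¬ (w < x))

  ChainIn : Carrier → Carrier → Subset → Set (c ⊔ ℓ₁ ⊔ ℓ₂)
  ChainIn x y C =
    (∀ {a b} → a ≈ b → C a → C b) ×
    (∀ a → C a → x ≤ a × a ≤ y) ×
    (∀ a b → C a → C b → a ≤ b ⊎ b ≤ a)

  MaximalChainIn : Carrier → Carrier → Subset → Set _
  MaximalChainIn x y C = ChainIn x y C × (∀ D → ChainIn x y D → C ⊆ D → D ⊆ C)

  HasCardinality : Subset → ℕ → Set (c ⊔ ℓ₁ ⊔ ℓ₂)
  HasCardinality C n = Σ (List Carrier) λ l →
    length l ≡ n × All C l × (∀ a → C a → Any (a ≈_) l) × AllPairs (λ a b → ¬ (a ≈ b)) l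

  Finite : Subset → Set _
  Finite C = ∃ λ n → HasCardinality C n

  Discrete : Set _
  Discrete = ∀ x y (C : Subset) → MaximalChainIn x y C → Finite C

  -- Height x y n : for x ≤ y, h(x,y) = n, i.e. the least cardinality of a
  -- maximal chain of [x,y] is n + 1
  Height : Carrier → Carrier → ℕ → Set _
  Height x y n =
    (Σ Subset λ C → MaximalChainIn x y C × HasCardinality C (suc n)) ×
    (∀ (C : Subset) m → MaximalChainIn x y C → HasCardinality C m → suc n ℕ.≤ m)

  Semimodular : Set _
  Semimodular = ∀ x y z → ¬ (x ≈ y) → z ⋖ x → z ⋖ y → (x ⋖ (x ∨ y)) × (y ⋖ (x ∨ y))

  ChebyshevDist : Carrier → Carrier → ℕ → Set _
  ChebyshevDist x y n = ∃ λ a → ∃ λ b →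
    Height x (x ∨ y) a × Height y (x ∨ y) b × n ≡ a ℕ.⊔ b

-- Semimodularity gives the diamond property: if a ⋖ a′ and s lies above a, then s ∨ a′ covers or
-- equals s. Pushing a covering chain a → t of length m along a covering chain a → s therefore
-- yields a covering chain s → s ∨ t of length at most m. Two consequences follow: all covering
-- chains between two elements have the same length (Jordan–Dedekind), and a covering chain from x
-- to p is no longer than one from x to any w ≥ p. Since a maximal chain with n + 1 elements is a
-- covering chain of length n, h(x, x ∨ z) is at most the length of the chain
-- x → x ∨ y → (x ∨ y) ∨ (y ∨ z), i.e. at most h(x, x ∨ y) + h(y, y ∨ z); symmetrically for z.
module Submission where

open import Defs hiding (_<_; _⋖_)
import Defs
open import Level using (Level; _⊔_)
open import Data.Nat as ℕ using (ℕ; zero; suc; _+_; z≤n; s≤s)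
open import Data.Nat.Properties
  using (≤-refl; ≤-trans; ≤-reflexive; n≤1+n; m≤m+n; +-mono-≤; +-monoʳ-≤; +-comm; suc-injective;
         m≤m⊔n; m≤n⊔m; ⊔-lub; _≤?_)
open import Data.Nat.Induction using (<-rec)
open import Data.Product using (∃; _×_; _,_; proj₁; proj₂; uncurry)
open import Data.Sum using (_⊎_; inj₁; inj₂; [_,_]′)
import Data.Sum as Sum
open import Data.Empty using (⊥-elim)
open import Data.List using (List; []; _∷_; length)
open import Data.List.Properties using (length-removeAt′)
open import Data.List.Relation.Unary.All using (All; lookupₛ)
open import Data.List.Relation.Unary.All.Properties using (─⁺)
open import Data.List.Relation.Unary.Any using (here; there; index)
open import Data.List.Relation.Unary.AllPairs using (AllPairs; _∷_)
open import Relation.Nullary using (¬_; yes; no)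
open import Relation.Nullary.Decidable using (decidable-stable; ¬¬-excluded-middle)
open import Relation.Binary.Core using (Rel)
open import Relation.Binary.Bundles using (Setoid; Poset)
open import Relation.Binary.PropositionalEquality using (_≡_)
import Relation.Binary.PropositionalEquality as ≡
open import Relation.Binary.Lattice.Bundles using (JoinSemilattice)

-- Equality in L is not decidable, so case distinctions on it are made in the double-negation
-- monad; this is harmless because the final conclusions are decidable inequalities of naturals.
infixl 1 _>>=_

_>>=_ : ∀ {a b} {A : Set a} {B : Set b} → ¬ ¬ A → (A → ¬ ¬ B) → ¬ ¬ B
(¬¬a >>= f) ¬b = ¬¬a (λ a → f a ¬b)

pure : ∀ {a} {A : Set a} → A → ¬ ¬ A
pure a ¬a = ¬a a

module SetoidRemoval {a ℓ} (S : Setoid a ℓ) where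
  open Setoid S
  open import Data.List.Membership.Setoid S using (_∈_; _─_)
  open import Data.List.Membership.Setoid.Properties using (∈-resp-≈; All[≉]⇒∉)

  ∈-─⁻ : ∀ {x y xs} (x∈xs : x ∈ xs) → y ∈ xs ─ x∈xs → y ∈ xs
  ∈-─⁻ (here _)    y∈        = there y∈
  ∈-─⁻ (there _)   (here y≈) = here y≈
  ∈-─⁻ (there x∈) (there y∈) = there (∈-─⁻ x∈ y∈)

  ∈-─⁺ : ∀ {x y xs} (x∈xs : x ∈ xs) → y ∈ xs → y ≈ x ⊎ y ∈ xs ─ x∈xs
  ∈-─⁺ (here x≈e) (here y≈e) = inj₁ (trans y≈e (sym x≈e))
  ∈-─⁺ (here _)    (there y∈) = inj₂ y∈
  ∈-─⁺ (there _)   (here y≈e) = inj₂ (here y≈e)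
  ∈-─⁺ (there x∈) (there y∈) = Sum.map₂ there (∈-─⁺ x∈ y∈)

  AllPairs-─ : ∀ {r} {R : Rel Carrier r} {x xs} (x∈xs : x ∈ xs) → AllPairs R xs → AllPairs R (xs ─ x∈xs)
  AllPairs-─ (here _)   (_ ∷ rs)  = rs
  AllPairs-─ (there x∈) (r ∷ rs) = ─⁺ x∈ r ∷ AllPairs-─ x∈ rs

  ∈-─⇒≉ : ∀ {x y xs} → AllPairs _≉_ xs → (x∈xs : x ∈ xs) → y ∈ xs ─ x∈xs → y ≉ x
  ∈-─⇒≉ (e≉ ∷ _)   (here x≈e) y∈         y≈x = All[≉]⇒∉ S e≉ (∈-resp-≈ S (trans y≈x x≈e) y∈)
  ∈-─⇒≉ (e≉ ∷ _)   (there x∈) (here y≈e) y≈x = All[≉]⇒∉ S e≉ (∈-resp-≈ S (trans (sym y≈x) y≈e) x∈)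
  ∈-─⇒≉ (_ ∷ ≉s) (there x∈) (there y∈) = ∈-─⇒≉ ≉s x∈ y∈

module SemimodularChains {c ℓ₁ ℓ₂ : Level} (L : JoinSemilattice c ℓ₁ ℓ₂) where
  open JoinSemilattice L

  ≈-setoid : Setoid c ℓ₁
  ≈-setoid = Poset.Eq.setoid poset

  open Setoid ≈-setoid using (_≉_)

  open import Relation.Binary.Lattice.Properties.JoinSemilattice L using (∨-comm; ∨-assoc; ∨-cong; x≤y⇒x∨y≈y)
  open import Relation.Binary.Properties.Poset poset using (_<_; <-irrefl; <-respˡ-≈)
  open import Data.List.Membership.Setoid ≈-setoid using (_∈_; _─_)
  open import Relation.Binary.Reasoning.Setoid ≈-setoid
  open SetoidRemoval ≈-setoid

  infix 4 _⋖_

  _⋖_ : Rel Carrier (c ⊔ ℓ₁ ⊔ ℓ₂)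
  _⋖_ = Defs._⋖_ L

  Comparable : Rel Carrier ℓ₂
  Comparable a b = a ≤ b ⊎ b ≤ a

  y≤x⇒x∨y≈x : ∀ {x y} → y ≤ x → x ∨ y ≈ x
  y≤x⇒x∨y≈x {x} {y} y≤x = Eq.trans (∨-comm x y) (x≤y⇒x∨y≈y y≤x)

  ⋖-respˡ-≈ : ∀ {a a′ b} → a ≈ a′ → a ⋖ b → a′ ⋖ b
  ⋖-respˡ-≈ a≈a′ (a<b , nothing-between) =
    <-respˡ-≈ a≈a′ a<b , λ w a′<w → nothing-between w (<-respˡ-≈ (Eq.sym a≈a′) a′<w)

  data CoverChain : Carrier → Carrier → ℕ → Set (c ⊔ ℓ₁ ⊔ ℓ₂) where
    done : ∀ {x y} → x ≈ y → CoverChain x y 0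
    step : ∀ {x y n} e → x ⋖ e → CoverChain e y n → CoverChain x y (suc n)

  CoverChain≤ : Carrier → Carrier → ℕ → Set (c ⊔ ℓ₁ ⊔ ℓ₂)
  CoverChain≤ x y n = ∃ λ m → m ℕ.≤ n × CoverChain x y m

  CoverChain-respˡ-≈ : ∀ {x x′ y n} → x ≈ x′ → CoverChain x y n → CoverChain x′ y n
  CoverChain-respˡ-≈ x≈x′ (done x≈y)       = done (Eq.trans (Eq.sym x≈x′) x≈y)
  CoverChain-respˡ-≈ x≈x′ (step e x⋖e e→y) = step e (⋖-respˡ-≈ x≈x′ x⋖e) e→y

  CoverChain-respʳ-≈ : ∀ {x y y′ n} → y ≈ y′ → CoverChain x y n → CoverChain x y′ n
  CoverChain-respʳ-≈ y≈y′ (done x≈y)       = done (Eq.trans x≈y y≈y′)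
  CoverChain-respʳ-≈ y≈y′ (step e x⋖e e→y) = step e x⋖e (CoverChain-respʳ-≈ y≈y′ e→y)

  CoverChain⇒≤ : ∀ {x y n} → CoverChain x y n → x ≤ y
  CoverChain⇒≤ (done x≈y)               = reflexive x≈y
  CoverChain⇒≤ (step _ ((x≤e , _) , _) e→y) = trans x≤e (CoverChain⇒≤ e→y)

  step⇒< : ∀ {x e y n} → x ⋖ e → CoverChain e y n → x < y
  step⇒< ((x≤e , x≉e) , _) e→y =
    trans x≤e e≤y , λ x≈y → x≉e (antisym x≤e (trans e≤y (reflexive (Eq.sym x≈y))))
    where e≤y = CoverChain⇒≤ e→y

  infixr 5 _++_

  _++_ : ∀ {x y z m n} → CoverChain x y m → CoverChain y z n → CoverChain x z (m + n)
  done x≈y       ++ y→z = CoverChain-respˡ-≈ (Eq.sym x≈y) y→z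
  step e x⋖e e→y ++ y→z = step e x⋖e (e→y ++ y→z)

  module _ (semimodular : Semimodular L) where

    cover-lift : ∀ {a a′ s k} → a ⋖ a′ → CoverChain a s k →
                 ¬ ¬ (CoverChain≤ s (s ∨ a′) 1 × CoverChain≤ a′ (s ∨ a′) k)
    cover-lift {a′ = a′} {s} a⋖a′@((a≤a′ , _) , _) (done a≈s) =
      pure ((1 , ≤-refl , step a′ (⋖-respˡ-≈ a≈s a⋖a′) (done a′≈s∨a′)) , (0 , z≤n , done a′≈s∨a′))
      where
      a′≈s∨a′ : a′ ≈ s ∨ a′
      a′≈s∨a′ = Eq.sym (x≤y⇒x∨y≈y (trans (reflexive (Eq.sym a≈s)) a≤a′))
    cover-lift {a} {a′} {s} a⋖a′ (step s₁ a⋖s₁ s₁→s) = ¬¬-excluded-middle >>= λ where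
        (yes a′≈s₁) →
          let s∨a′≈s = y≤x⇒x∨y≈x (trans (reflexive a′≈s₁) s₁≤s) in
          pure ( (0 , z≤n , done (Eq.sym s∨a′≈s))
               , (_ , n≤1+n _ , CoverChain-respʳ-≈ (Eq.sym s∨a′≈s) (CoverChain-respˡ-≈ (Eq.sym a′≈s₁) s₁→s)))
        (no a′≉s₁) → do
          let (a′⋖m , s₁⋖m) = semimodular a′ s₁ a a′≉s₁ a⋖a′ a⋖s₁
          (j , j≤1 , s→s∨m) , (k′ , k′≤k , m→s∨m) ← cover-lift s₁⋖m s₁→s
          pure ( (j , j≤1 , CoverChain-respʳ-≈ s∨m≈s∨a′ s→s∨m)
               , (suc k′ , s≤s k′≤k , step _ a′⋖m (CoverChain-respʳ-≈ s∨m≈s∨a′ m→s∨m)))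
      where
      s₁≤s = CoverChain⇒≤ s₁→s
      s∨m≈s∨a′ : s ∨ (a′ ∨ s₁) ≈ s ∨ a′
      s∨m≈s∨a′ = begin
        s ∨ (a′ ∨ s₁)  ≈⟨ ∨-cong Eq.refl (∨-comm a′ s₁) ⟩
        s ∨ (s₁ ∨ a′)  ≈⟨ ∨-assoc s s₁ a′ ⟨
        (s ∨ s₁) ∨ a′  ≈⟨ ∨-cong (y≤x⇒x∨y≈x s₁≤s) Eq.refl ⟩
        s ∨ a′         ∎

    diamond : ∀ {a s t k m} → CoverChain a s k → CoverChain a t m → ¬ ¬ CoverChain≤ s (s ∨ t) m
    diamond a→s (done a≈t) =
      pure (0 , z≤n , done (Eq.sym (y≤x⇒x∨y≈x (trans (reflexive (Eq.sym a≈t)) (CoverChain⇒≤ a→s)))))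
    diamond {s = s} {t} a→s (step t₁ a⋖t₁ t₁→t) = do
      (j , j≤1 , s→s∨t₁) , (_ , _ , t₁→s∨t₁) ← cover-lift a⋖t₁ a→s
      (i , i≤m , s∨t₁→s∨t) ← diamond t₁→s∨t₁ t₁→t
      pure (j + i , +-mono-≤ j≤1 i≤m , s→s∨t₁ ++ CoverChain-respʳ-≈ s∨t₁∨t≈s∨t s∨t₁→s∨t)
      where
      s∨t₁∨t≈s∨t : (s ∨ t₁) ∨ t ≈ s ∨ t
      s∨t₁∨t≈s∨t = Eq.trans (∨-assoc s t₁ t) (∨-cong Eq.refl (x≤y⇒x∨y≈y (CoverChain⇒≤ t₁→t)))

    jordan-dedekind : ∀ {x w m n} → CoverChain x w n → CoverChain x w m → ¬ ¬ (m ℕ.≤ n)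
    jordan-dedekind {n = n} = <-rec P by-induction n
      where
      P : ℕ → Set (c ⊔ ℓ₁ ⊔ ℓ₂)
      P n = ∀ {x w m} → CoverChain x w n → CoverChain x w m → ¬ ¬ (m ℕ.≤ n)
      by-induction : ∀ n → (∀ {k} → k ℕ.< n → P k) → P n
      by-induction _ _  (done _)             (done _)             = pure z≤n
      by-induction _ _  (done x≈w)           (step _ x⋖p p→w)     = ⊥-elim (<-irrefl x≈w (step⇒< x⋖p p→w))
      by-induction _ _  (step _ x⋖q q→w)     (done x≈w)           = ⊥-elim (<-irrefl x≈w (step⇒< x⋖q q→w))
      by-induction (suc n) ih {x} (step q x⋖q q→w) (step p x⋖p p→w) = ¬¬-excluded-middle >>= λ where
        (yes p≈q) → do
          m≤n ← ih ≤-refl q→w (CoverChain-respˡ-≈ p≈q p→w)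
          pure (s≤s m≤n)
        -- Route both chains through p ∨ q: the diamond makes p ∨ q → w no longer than q → w,
        -- so both comparisons below are with chains shorter than the original one.
        (no p≉q) → do
          let (p⋖p∨q , q⋖p∨q) = semimodular p q x p≉q x⋖p x⋖q
              p∨q∨w≈w = x≤y⇒x∨y≈y (∨-least (CoverChain⇒≤ p→w) (CoverChain⇒≤ q→w))
          (k , _ , p∨q→p∨q∨w) ← diamond (step _ q⋖p∨q (done Eq.refl)) q→w
          let p∨q→w = CoverChain-respʳ-≈ p∨q∨w≈w p∨q→p∨q∨w
          1+k≤n ← ih ≤-refl q→w (step _ q⋖p∨q p∨q→w)
          m≤1+k ← ih (s≤s 1+k≤n) (step _ p⋖p∨q p∨q→w) p→w
          pure (s≤s (≤-trans m≤1+k 1+k≤n))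

    length-mono : ∀ {x p w a n} → CoverChain x p a → CoverChain x w n → p ≤ w → ¬ ¬ (a ℕ.≤ n)
    length-mono {a = a} x→p x→w p≤w = do
      (k , _ , p→p∨w) ← diamond x→p x→w
      a+k≤n ← jordan-dedekind x→w (x→p ++ CoverChain-respʳ-≈ (x≤y⇒x∨y≈y p≤w) p→p∨w)
      pure (≤-trans (m≤m+n a k) a+k≤n)

    height-triangle : ∀ {x y p u v a b b′ c} →
                      CoverChain x p a → CoverChain x u b → CoverChain y u b′ → CoverChain y v c →
                      p ≤ u ∨ v → ¬ ¬ (a ℕ.≤ b + c)
    height-triangle {b = b} x→p x→u y→u y→v p≤u∨v = do
      (k , k≤c , u→u∨v) ← diamond y→u y→v
      a≤b+k ← length-mono x→p (x→u ++ u→u∨v) p≤u∨v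
      pure (≤-trans a≤b+k (+-monoʳ-≤ b k≤c))

  maximal-chain-∋-comparable : ∀ {x y z} {C : Subset L} → MaximalChainIn L x y C →
                               x ≤ z → z ≤ y → (∀ a → C a → Comparable a z) → C z
  maximal-chain-∋-comparable {x} {y} {z} {C} ((C-resp , C-bounded , C-comparable) , maximal) x≤z z≤y z~C =
    maximal D (D-resp , D-bounded , D-comparable) inj₁ (inj₂ Eq.refl)
    where
    D : Subset L
    D a = C a ⊎ a ≈ z
    D-resp : ∀ {a b} → a ≈ b → D a → D b
    D-resp a≈b = Sum.map (C-resp a≈b) (Eq.trans (Eq.sym a≈b))
    D-bounded : ∀ a → D a → x ≤ a × a ≤ y
    D-bounded a (inj₁ Ca)  = C-bounded a Ca
    D-bounded a (inj₂ a≈z) = trans x≤z (reflexive (Eq.sym a≈z)) , trans (reflexive a≈z) z≤y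
    z~D : ∀ {a b} → C a → b ≈ z → Comparable a b
    z~D {a} Ca b≈z = Sum.map (λ a≤z → trans a≤z (reflexive (Eq.sym b≈z))) (trans (reflexive b≈z)) (z~C a Ca)
    D-comparable : ∀ a b → D a → D b → Comparable a b
    D-comparable a b (inj₁ Ca)  (inj₁ Cb)  = C-comparable a b Ca Cb
    D-comparable a b (inj₁ Ca)  (inj₂ b≈z) = z~D Ca b≈z
    D-comparable a b (inj₂ a≈z) (inj₁ Cb)  = Sum.swap (z~D Cb a≈z)
    D-comparable a b (inj₂ a≈z) (inj₂ b≈z) = inj₁ (reflexive (Eq.trans a≈z (Eq.sym b≈z)))

  record MaximalChainList (x y : Carrier) (l : List Carrier) : Set (c ⊔ ℓ₁ ⊔ ℓ₂) where
    field
      bounded    : ∀ {a} → a ∈ l → x ≤ a × a ≤ y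
      comparable : ∀ {a b} → a ∈ l → b ∈ l → Comparable a b
      distinct   : AllPairs _≉_ l
      maximal    : ∀ {z} → x ≤ z → z ≤ y → (∀ {a} → a ∈ l → Comparable a z) → z ∈ l

  minimum : ∀ {k} l → length l ≡ suc k → (∀ {a b} → a ∈ l → b ∈ l → Comparable a b) →
            ∃ λ m → m ∈ l × (∀ {a} → a ∈ l → m ≤ a)
  minimum (e ∷ []) _ _ = e , here Eq.refl , λ where
    (here a≈e) → reflexive (Eq.sym a≈e)
  minimum (e ∷ f ∷ l) _ cmp with minimum (f ∷ l) ≡.refl (λ a∈ b∈ → cmp (there a∈) (there b∈))
  ... | m , m∈ , m-least with cmp (here Eq.refl) (there m∈)
  ...   | inj₁ e≤m = e , here Eq.refl , λ where
          (here a≈e) → reflexive (Eq.sym a≈e)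
          (there a∈) → trans e≤m (m-least a∈)
  ...   | inj₂ m≤e = m , there m∈ , λ where
          (here a≈e) → trans m≤e (reflexive (Eq.sym a≈e))
          (there a∈) → m-least a∈

  module _ {x y l} (chain : MaximalChainList x y l) where
    open MaximalChainList chain

    bottom∈ : ∀ {a} → a ∈ l → x ∈ l
    bottom∈ a∈l = maximal refl (uncurry trans (bounded a∈l)) (λ b∈l → inj₂ (proj₁ (bounded b∈l)))

    top∈ : ∀ {a} → a ∈ l → y ∈ l
    top∈ a∈l = maximal (uncurry trans (bounded a∈l)) refl (λ b∈l → inj₁ (proj₂ (bounded b∈l)))

    drop-bottom : (x∈l : x ∈ l) → ∀ {x₁} → x₁ ∈ l ─ x∈l → (∀ {a} → a ∈ l ─ x∈l → x₁ ≤ a) →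
                  x ⋖ x₁ × MaximalChainList x₁ y (l ─ x∈l)
    drop-bottom x∈l {x₁} x₁∈l′ x₁-least = x⋖x₁ , record
      { bounded    = λ a∈l′ → x₁-least a∈l′ , proj₂ (bounded (∈-─⁻ x∈l a∈l′))
      ; comparable = λ a∈l′ b∈l′ → comparable (∈-─⁻ x∈l a∈l′) (∈-─⁻ x∈l b∈l′)
      ; distinct   = AllPairs-─ x∈l distinct
      ; maximal    = maximal′
      }
      where
      x≤x₁ : x ≤ x₁
      x≤x₁ = proj₁ (bounded (∈-─⁻ x∈l x₁∈l′))
      x₁≉x : x₁ ≉ x
      x₁≉x = ∈-─⇒≉ distinct x∈l x₁∈l′
      x₁≤y : x₁ ≤ y
      x₁≤y = proj₂ (bounded (∈-─⁻ x∈l x₁∈l′))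
      ≈x⊎∈l′ : ∀ {z} → x ≤ z → z ≤ y → (∀ {a} → a ∈ l ─ x∈l → Comparable a z) → z ≈ x ⊎ z ∈ l ─ x∈l
      ≈x⊎∈l′ x≤z z≤y z~l′ = ∈-─⁺ x∈l (maximal x≤z z≤y z~l)
        where
        z~l : ∀ {a} → a ∈ l → Comparable a _
        z~l a∈l = [ (λ a≈x → inj₁ (trans (reflexive a≈x) x≤z)) , z~l′ ]′ (∈-─⁺ x∈l a∈l)
      x⋖x₁ : x ⋖ x₁
      x⋖x₁ = (x≤x₁ , λ x≈x₁ → x₁≉x (Eq.sym x≈x₁)) , λ w (x≤w , x≉w) (w≤x₁ , w≉x₁) →
        [ (λ w≈x → x≉w (Eq.sym w≈x)) , (λ w∈l′ → w≉x₁ (antisym w≤x₁ (x₁-least w∈l′))) ]′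
          (≈x⊎∈l′ x≤w (trans w≤x₁ x₁≤y) (λ a∈l′ → inj₂ (trans w≤x₁ (x₁-least a∈l′))))
      maximal′ : ∀ {z} → x₁ ≤ z → z ≤ y → (∀ {a} → a ∈ l ─ x∈l → Comparable a z) → z ∈ l ─ x∈l
      maximal′ x₁≤z z≤y z~l′ =
        [ (λ z≈x → ⊥-elim (x₁≉x (antisym (trans x₁≤z (reflexive z≈x)) x≤x₁))) , (λ z∈l′ → z∈l′) ]′
          (≈x⊎∈l′ (trans x≤x₁ x₁≤z) z≤y z~l′)

  MaximalChainList⇒CoverChain : ∀ n {x y} l → length l ≡ suc n → MaximalChainList x y l → CoverChain x y n
  MaximalChainList⇒CoverChain zero (e ∷ []) _ chain
    with bottom∈ chain (here Eq.refl) | top∈ chain (here Eq.refl)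
  ... | here x≈e | here y≈e = done (Eq.trans x≈e (Eq.sym y≈e))
  MaximalChainList⇒CoverChain (suc n) l@(_ ∷ _) len chain =
    let (x₁ , x₁∈l′ , x₁-least) = minimum (l ─ x∈l) len′ comparable′
        (x⋖x₁ , chain′)         = drop-bottom chain x∈l x₁∈l′ x₁-least
    in step x₁ x⋖x₁ (MaximalChainList⇒CoverChain n (l ─ x∈l) len′ chain′)
    where
    x∈l = bottom∈ chain (here Eq.refl)
    len′ : length (l ─ x∈l) ≡ suc n
    len′ = suc-injective (≡.trans (≡.sym (length-removeAt′ l (index x∈l))) len)
    comparable′ : ∀ {a b} → a ∈ l ─ x∈l → b ∈ l ─ x∈l → Comparable a b
    comparable′ a∈ b∈ = MaximalChainList.comparable chain (∈-─⁻ x∈l a∈) (∈-─⁻ x∈l b∈)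

  maximal-chain⇒MaximalChainList : ∀ {x y l} {C : Subset L} → MaximalChainIn L x y C →
                                   All C l → (∀ a → C a → a ∈ l) → AllPairs _≉_ l → MaximalChainList x y l
  maximal-chain⇒MaximalChainList {C = C} C-maximal@((C-resp , C-bounded , C-comparable) , _)
                                 C-all l-covers l-distinct =
    record
      { bounded    = λ a∈l → C-bounded _ (C∋ a∈l)
      ; comparable = λ a∈l b∈l → C-comparable _ _ (C∋ a∈l) (C∋ b∈l)
      ; distinct   = l-distinct
      ; maximal    = λ x≤z z≤y z~l →
          l-covers _ (maximal-chain-∋-comparable C-maximal x≤z z≤y (λ a Ca → z~l (l-covers a Ca)))
      }
    where
    C∋ : ∀ {a} → a ∈ _ → C a
    C∋ = lookupₛ ≈-setoid C-resp C-all

  height⇒CoverChain : ∀ {x y n} → Height L x y n → CoverChain x y n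
  height⇒CoverChain ((C , C-maximal , l , len , C-all , l-covers , l-distinct) , _) =
    MaximalChainList⇒CoverChain _ l len (maximal-chain⇒MaximalChainList C-maximal C-all l-covers l-distinct)

open import Data.Nat using (_≤_)

proposition5 : {c ℓ₁ ℓ₂ : Level} (L : JoinSemilattice c ℓ₁ ℓ₂) →
    Discrete L → Semimodular L →
    ∀ x y z (dxz dxy dyz : ℕ) →
    ChebyshevDist L x z dxz → ChebyshevDist L x y dxy → ChebyshevDist L y z dyz →
    dxz ≤ dxy + dyz
proposition5 L _ semimodular x y z _ _ _
  (a₁ , a₂ , x→x∨z , z→x∨z , ≡.refl) (b₁ , b₂ , x→x∨y , y→x∨y , ≡.refl) (c₁ , c₂ , y→y∨z , z→y∨z , ≡.refl) =
  ⊔-lub (≤-trans a₁≤b₁+c₁ (+-mono-≤ (m≤m⊔n b₁ b₂) (m≤m⊔n c₁ c₂)))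
        (≤-trans a₂≤b₂+c₂ (+-mono-≤ (m≤n⊔m b₁ b₂) (m≤n⊔m c₁ c₂)))
  where
  open JoinSemilattice L using (x≤x∨y; y≤x∨y; ∨-least; trans)
  open SemimodularChains L
  a₁≤b₁+c₁ : a₁ ≤ b₁ + c₁
  a₁≤b₁+c₁ = decidable-stable (a₁ ≤? b₁ + c₁)
    (height-triangle semimodular (height⇒CoverChain x→x∨z) (height⇒CoverChain x→x∨y)
       (height⇒CoverChain y→x∨y) (height⇒CoverChain y→y∨z)
       (∨-least (trans (x≤x∨y x y) (x≤x∨y _ _)) (trans (y≤x∨y y z) (y≤x∨y _ _))))
  a₂≤c₂+b₂ : a₂ ≤ c₂ + b₂
  a₂≤c₂+b₂ = decidable-stable (a₂ ≤? c₂ + b₂)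
    (height-triangle semimodular (height⇒CoverChain z→x∨z) (height⇒CoverChain z→y∨z)
       (height⇒CoverChain y→y∨z) (height⇒CoverChain y→x∨y)
       (∨-least (trans (x≤x∨y x y) (y≤x∨y _ _)) (trans (y≤x∨y y z) (x≤x∨y _ _))))
  a₂≤b₂+c₂ : a₂ ≤ b₂ + c₂
  a₂≤b₂+c₂ = ≤-trans a₂≤c₂+b₂ (≤-reflexive (+-comm c₂ b₂))
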